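{- Let $\mathcal{V}$ be either $\mathsf{Pre}$ or $\mathsf{Pos}$ and let $T:\mathcal{V}\to\mathcal{V}$ be a locally monotone functor. The following are equivalent: (1) $T$ preserves lax exact squares; (2) $T$ preserves strict exact squares and preserves exactness of comma squares of the form $1_{\mathscr{A}}/1_{\mathscr{A}}$, for all $\mathscr{A}$; (3) $T$ preserves strict exact squares and preserves exactness of comma squares of the forms $f/1_{\mathscr{B}}$ and $1_{\mathscr{A}}/f$, for all monotone $f:\mathscr{A}\to\mathscr{B}$; (4) $T$ preserves strict exact squares and preserves exactness of all comma squares.
   Context: $\mathsf{Pre}$ ($\mathsf{Pos}$) is the category of preorders (posets) and monotone maps; $\mathscr{X}(x,x')\in\{0,1\}$ is the truth value of $x\le x'$. $T$ is locally monotone if $f\le g$ pointwise implies $Tf\le Tg$ pointwise. A lax square consists of monotone maps $p_0:\mathscr{P}\to\mathscr{A}$, $p_1:\mathscr{P}\to\mathscr{B}$, $f:\mathscr{A}\to\mathscr{C}$, $g:\mathscr{B}\to\mathscr{C}$ with $f\circ p_0\le g\circ p_1$ pointwise; it is exact iff for all $a\in\mathscr{A}$, $b\in\mathscr{B}$: $\mathscr{C}(fa,gb)=\bigvee_{w\in\mathscr{P}}\mathscr{A}(a,p_0w)\wedge\mathscr{B}(p_1w,b)$. It is strict if $f\circ p_0=g\circ p_1$. A locally monotone $T$ sends lax squares to lax squares; $T$ preserves a class of exact squares if it sends each exact square in the class to an exact square. The comma square of $f:\mathscr{A}\to\mathscr{C}$, $g:\mathscr{B}\to\mathscr{C}$ is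 the lax square with $\mathscr{P}=f/g=\{(a,b):fa\le gb\}$ (componentwise order) and $p_0,p_1$ the projections. -}

module Defs where

open import Level using (Level)
open import Data.Unit using (⊤; tt)
open import Data.Product using (Σ; ∃; _×_; _,_; proj₁; proj₂; Σ-syntax; ∃-syntax)
open import Function.Bundles using (_⇔_)
open import Relation.Binary.PropositionalEquality using (_≡_; refl)

data Base : Set where
  Pre Pos : Base

AntisymIf : Base → {A : Set} → (A → A → Set) → Set
AntisymIf Pre R = ⊤
AntisymIf Pos {A} R = ∀ {x y : A} → R x y → R y x → x ≡ y

-- An object of 𝒱: a (small) preorder whose order relation is truth-valued
-- (proof-irrelevant), antisymmetric when 𝒱 = Pos.
record Obj (V : Base) : Set₁ where
  field
    Carrier : Set
    _≤_     : Carrier → Carrier → Set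
    ≤-prop  : ∀ {x y} (p q : x ≤ y) → p ≡ q
    ≤-refl  : ∀ {x} → x ≤ x
    ≤-trans : ∀ {x y z} → x ≤ y → y ≤ z → x ≤ z
    ≤-antisym : AntisymIf V _≤_
open Obj public

-- ℛ ⟦ x ≤ y ⟧ is ℛ(x,y)
_⟦_≤_⟧ : ∀ {V} (X : Obj V) → Carrier X → Carrier X → Set
X ⟦ x ≤ y ⟧ = _≤_ X x y

record Mono {V : Base} (A B : Obj V) : Set where
  field
    fun  : Carrier A → Carrier B
    mono : ∀ {x y} → A ⟦ x ≤ y ⟧ → B ⟦ fun x ≤ fun y ⟧
open Mono public

idM : ∀ {V} (A : Obj V) → Mono A A
idM A = record { fun = λ x → x ; mono = λ p → p }

_∘M_ : ∀ {V} {A B C : Obj V} → Mono B C → Mono A B → Mono A C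
g ∘M f = record { fun = λ x → fun g (fun f x) ; mono = λ p → mono g (mono f p) }

_≐_ : ∀ {V} {A B : Obj V} → Mono A B → Mono A B → Set
f ≐ g = ∀ x → fun f x ≡ fun g x

_≼_ : ∀ {V} {A B : Obj V} → Mono A B → Mono A B → Set
_≼_ {B = B} f g = ∀ x → B ⟦ fun f x ≤ fun g x ⟧

-- A locally monotone endofunctor T : 𝒱 → 𝒱.  Morphisms of 𝒱 are monotone maps
-- identified up to pointwise equality (hence the congruence field).
record LocMonFunctor (V : Base) : Set₁ where
  field
    F₀ : Obj V → Obj V
    F₁ : ∀ {A B} → Mono A B → Mono (F₀ A) (F₀ B)
    F-resp : ∀ {A B} {f g : Mono A B} → f ≐ g → F₁ f ≐ F₁ g
    F-id   : ∀ {A} → F₁ (idM A) ≐ idM (F₀ A)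
    F-∘    : ∀ {A B C} (g : Mono B C) (f : Mono A B) → F₁ (g ∘M f) ≐ (F₁ g ∘M F₁ f)
    F-locmono : ∀ {A B} {f g : Mono A B} → f ≼ g → F₁ f ≼ F₁ g
open LocMonFunctor public

record Square (V : Base) : Set₁ where
  field
    P A B C : Obj V
    p₀ : Mono P A
    p₁ : Mono P B
    f  : Mono A C
    g  : Mono B C
open Square public

Lax : ∀ {V} → Square V → Set
Lax s = ∀ w → C s ⟦ fun (f s) (fun (p₀ s) w) ≤ fun (g s) (fun (p₁ s) w) ⟧

Strict : ∀ {V} → Square V → Set
Strict s = ∀ w → fun (f s) (fun (p₀ s) w) ≡ fun (g s) (fun (p₁ s) w)

-- Exactness: 𝒞(fa,gb) = ⋁_w 𝒜(a,p₀w) ∧ ℬ(p₁w,b)  (equality of truth values)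
Exact : ∀ {V} → Square V → Set
Exact s = ∀ (a : Carrier (A s)) (b : Carrier (B s)) →
  (C s ⟦ fun (f s) a ≤ fun (g s) b ⟧)
    ⇔ (∃[ w ] (A s ⟦ a ≤ fun (p₀ s) w ⟧ × B s ⟦ fun (p₁ s) w ≤ b ⟧))

mapSquare : ∀ {V} → LocMonFunctor V → Square V → Square V
mapSquare T s = record
  { P = F₀ T (P s) ; A = F₀ T (A s) ; B = F₀ T (B s) ; C = F₀ T (C s)
  ; p₀ = F₁ T (p₀ s) ; p₁ = F₁ T (p₁ s) ; f = F₁ T (f s) ; g = F₁ T (g s) }

module _ {V : Base} {A B C : Obj V} (f : Mono A C) (g : Mono B C) where

  CommaCarrier : Set
  CommaCarrier = Σ[ ab ∈ Carrier A × Carrier B ] (C ⟦ fun f (proj₁ ab) ≤ fun g (proj₂ ab) ⟧)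

  private
    _⊑_ : CommaCarrier → CommaCarrier → Set
    ((a , b) , _) ⊑ ((a' , b') , _) = (A ⟦ a ≤ a' ⟧) × (B ⟦ b ≤ b' ⟧)

    ⊑-prop : ∀ {x y} (p q : x ⊑ y) → p ≡ q
    ⊑-prop (p₁ , p₂) (q₁ , q₂) with ≤-prop A p₁ q₁ | ≤-prop B p₂ q₂
    ... | refl | refl = refl

    ⊑-antisym : (V : Base) → AntisymIf V {A = Carrier A} (_≤_ A) →
                AntisymIf V {A = Carrier B} (_≤_ B) → AntisymIf V _⊑_
    ⊑-antisym Pre _ _ = tt
    ⊑-antisym Pos antA antB {(a , b) , r} {(a' , b') , r'} (x₁ , x₂) (y₁ , y₂)
      with antA x₁ y₁ | antB x₂ y₂
    ... | refl | refl with ≤-prop C r r'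
    ... | refl = refl

  Comma : Obj V
  Comma = record
    { Carrier = CommaCarrier
    ; _≤_ = _⊑_
    ; ≤-prop = λ {x} {y} → ⊑-prop {x} {y}
    ; ≤-refl = ≤-refl A , ≤-refl B
    ; ≤-trans = λ (p , q) (p' , q') → ≤-trans A p p' , ≤-trans B q q'
    ; ≤-antisym = ⊑-antisym V (≤-antisym A) (≤-antisym B)
    }

  commaSquare : Square V
  commaSquare = record
    { P = Comma ; A = A ; B = B ; C = C
    ; p₀ = record { fun = λ x → proj₁ (proj₁ x) ; mono = proj₁ }
    ; p₁ = record { fun = λ x → proj₂ (proj₁ x) ; mono = proj₂ }
    ; f = f ; g = g }

PreservesLaxExact : ∀ {V} → LocMonFunctor V → Set₁
PreservesLaxExact {V} T = ∀ (s : Square V) → Lax s → Exact s → Exact (mapSquare T s)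

PreservesStrictExact : ∀ {V} → LocMonFunctor V → Set₁
PreservesStrictExact {V} T = ∀ (s : Square V) → Strict s → Exact s → Exact (mapSquare T s)

PreservesCommaExact : ∀ {V} → LocMonFunctor V → {A B C : Obj V} → Mono A C → Mono B C → Set
PreservesCommaExact T f g = Exact (mapSquare T (commaSquare f g))

PreservesIdIdComma : ∀ {V} → LocMonFunctor V → Set₁
PreservesIdIdComma {V} T = ∀ (A : Obj V) → PreservesCommaExact T (idM A) (idM A)

-- (3): comma squares f/1_ℬ and 1_ℬ/f (the only well-typed reading of 1_𝒜/f for f : 𝒜 → ℬ)
PreservesOneSidedComma : ∀ {V} → LocMonFunctor V → Set₁
PreservesOneSidedComma {V} T = ∀ (A B : Obj V) (f : Mono A B) →
  PreservesCommaExact T f (idM B) × PreservesCommaExact T (idM B) f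

PreservesAllComma : ∀ {V} → LocMonFunctor V → Set₁
PreservesAllComma {V} T = ∀ (A B C : Obj V) (f : Mono A C) (g : Mono B C) →
  PreservesCommaExact T f g

module Submission where

-- Exactness of a square splits into two halves.  The half "some w connects a
-- to b ⇒ fa ≤ gb" holds for every lax square, and T preserves laxness by local
-- monotonicity; so everything is about the other half, called Reflects below.
-- Reflects is stable under horizontal and vertical pasting and under
-- replacing a square by one that dominates it.  The key construction factors
-- a lax exact square  (p₀, p₁ ; f, g)  over C as a 2×2 grid whose lower right
-- cell is the comma square 1_C/1_C and whose other three cells are strict
-- exact squares (the comma objects f/1_C, 1_C/g and one over them built from
-- the exactness of the given square); this grid is dominated by the original
-- square.  Applying T to the grid gives (2) ⇒ lax preservation.  The
-- remaining implications are immediate, since comma squares are lax exact and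
-- 1/1 is both of the form f/1 and a comma square.

open import Defs
open import Data.Product using (_×_; _,_; proj₁; proj₂; ∃-syntax)
open import Function.Bundles using (_⇔_; mk⇔; Equivalence)
open import Relation.Binary.PropositionalEquality using (_≡_; refl; sym)

≡⇒≤ : ∀ {V} (X : Obj V) {x y : Carrier X} → x ≡ y → X ⟦ x ≤ y ⟧
≡⇒≤ X refl = ≤-refl X

-- The nontrivial half of exactness, stated for bare maps so that pasted
-- squares need not be packaged as Square records: every fa ≤ gb is
-- witnessed by some w with a ≤ u w and v w ≤ b.
record Reflects {V} {P A B C : Obj V}
                (u : Mono P A) (v : Mono P B) (f : Mono A C) (g : Mono B C) : Set where
  constructor reflects
  field
    witness : ∀ a b → C ⟦ fun f a ≤ fun g b ⟧ →
              ∃[ w ] (A ⟦ a ≤ fun u w ⟧ × B ⟦ fun v w ≤ b ⟧)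
open Reflects

exactReflects : ∀ {V} {s : Square V} → Exact s → Reflects (p₀ s) (p₁ s) (f s) (g s)
exactReflects ex = reflects λ a b → Equivalence.to (ex a b)

laxSound : ∀ {V} (s : Square V) → Lax s → ∀ a b →
  ∃[ w ] (A s ⟦ a ≤ fun (p₀ s) w ⟧ × B s ⟦ fun (p₁ s) w ≤ b ⟧) →
  C s ⟦ fun (f s) a ≤ fun (g s) b ⟧
laxSound s lax a b (w , a≤p₀w , p₁w≤b) =
  ≤-trans (C s) (mono (f s) a≤p₀w) (≤-trans (C s) (lax w) (mono (g s) p₁w≤b))

laxReflects⇒exact : ∀ {V} (s : Square V) → Lax s →
  Reflects (p₀ s) (p₁ s) (f s) (g s) → Exact s
laxReflects⇒exact s lax half a b = mk⇔ (witness half a b) (laxSound s lax a b)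

strict⇒lax : ∀ {V} (s : Square V) → Strict s → Lax s
strict⇒lax s strict w = ≡⇒≤ (C s) (strict w)

commaLax : ∀ {V} {A B C : Obj V} (f : Mono A C) (g : Mono B C) → Lax (commaSquare f g)
commaLax f g w = proj₂ w

commaExact : ∀ {V} {A B C : Obj V} (f : Mono A C) (g : Mono B C) →
  Exact (commaSquare f g)
commaExact {A = A} {B} f g = laxReflects⇒exact (commaSquare f g) (commaLax f g)
  (reflects λ a b fa≤gb → ((a , b) , fa≤gb) , ≤-refl A , ≤-refl B)

pasteHorizontal : ∀ {V} {P A B C D E : Obj V}
  {u : Mono P A} {v : Mono P B} {f : Mono A C} {g : Mono B C}
  {k : Mono B D} {l : Mono C E} {h : Mono D E} →
  Reflects u v f g → Reflects g k l h → Reflects u (k ∘M v) (l ∘M f) h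
pasteHorizontal {D = D} {f = f} {k = k} left right = reflects λ a d lfa≤hd →
  let (b , fa≤gb , kb≤d) = witness right (fun f a) d lfa≤hd
      (w , a≤uw , vw≤b)  = witness left a b fa≤gb
  in w , a≤uw , ≤-trans D (mono k vw≤b) kb≤d

pasteVertical : ∀ {V} {P A B C X Y : Obj V}
  {u : Mono P A} {v : Mono P B} {f : Mono A C} {g : Mono B C}
  {m : Mono A X} {x : Mono X Y} {n : Mono C Y} →
  Reflects u v f g → Reflects m f x n → Reflects (m ∘M u) v x (n ∘M g)
pasteVertical {X = X} {g = g} {m = m} top bottom = reflects λ a b xa≤ngb →
  let (a' , a≤ma' , fa'≤gb) = witness bottom a (fun g b) xa≤ngb
      (w , a'≤uw , vw≤b)    = witness top a' b fa'≤gb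
  in w , ≤-trans X a≤ma' (mono m a'≤uw) , vw≤b

reflectsCompare : ∀ {V} {P P' A B C : Obj V}
  {u : Mono P A} {v : Mono P B} {f : Mono A C} {g : Mono B C}
  {u' : Mono P' A} {v' : Mono P' B} {f' : Mono A C} {g' : Mono B C} →
  Reflects u' v' f' g' → (k : Mono P' P) →
  u' ≼ (u ∘M k) → (v ∘M k) ≼ v' → f' ≼ f → g ≼ g' → Reflects u v f g
reflectsCompare {A = A} {B} {C} {f = f} {g} {v' = v'} {g' = g'}
                dominating k u'≼uk vk≼v' f'≼f g≼g' = reflects λ a b fa≤gb →
  let (w , a≤u'w , v'w≤b) = witness dominating a b
        (≤-trans C (f'≼f a) (≤-trans C fa≤gb (g≼g' b)))
  in fun k w , ≤-trans A a≤u'w (u'≼uk w) , ≤-trans B (vk≼v' w) v'w≤b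

module _ {V : Base} (T : LocMonFunctor V) where

  mapTwoCell : ∀ {X A B C : Obj V}
    (h : Mono X A) (f : Mono A C) (k : Mono X B) (g : Mono B C) →
    (f ∘M h) ≼ (g ∘M k) → (F₁ T f ∘M F₁ T h) ≼ (F₁ T g ∘M F₁ T k)
  mapTwoCell {C = C} h f k g cell x =
    ≤-trans (F₀ T C) (≡⇒≤ (F₀ T C) (sym (F-∘ T f h x)))
      (≤-trans (F₀ T C) (F-locmono T cell x) (≡⇒≤ (F₀ T C) (F-∘ T g k x)))

  mapLax : (s : Square V) → Lax s → Lax (mapSquare T s)
  mapLax s = mapTwoCell (p₀ s) (f s) (p₁ s) (g s)

  mapId≼ : ∀ {A C : Obj V} (h : Mono A (F₀ T C)) → (F₁ T (idM C) ∘M h) ≼ h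
  mapId≼ {C = C} h x = ≡⇒≤ (F₀ T C) (F-id T (fun h x))

  ≼mapId : ∀ {A C : Obj V} (h : Mono A (F₀ T C)) → h ≼ (F₁ T (idM C) ∘M h)
  ≼mapId {C = C} h x = ≡⇒≤ (F₀ T C) (sym (F-id T (fun h x)))

-- The arrow object C↓C = 1_C/1_C with its domain and codomain projections,
-- and the two strict exact squares expressing f/1_C and 1_C/g as pullbacks
-- of dom along f and of cod along g.
module Arrows {V : Base} (C : Obj V) where

  Arr : Obj V
  Arr = Comma (idM C) (idM C)

  dom cod : Mono Arr C
  dom = p₀ (commaSquare (idM C) (idM C))
  cod = p₁ (commaSquare (idM C) (idM C))

  domSquare : ∀ {A : Obj V} → Mono A C → Square V
  domSquare {A} f = record
    { P = Comma f (idM C) ; A = A ; B = Arr ; C = C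
    ; p₀ = p₀ (commaSquare f (idM C))
    ; p₁ = record { fun = λ { ((a , c) , fa≤c) → (fun f a , c) , fa≤c }
                  ; mono = λ { (a≤a' , c≤c') → mono f a≤a' , c≤c' } }
    ; f = f ; g = dom }

  domSquare-strict : ∀ {A : Obj V} (f : Mono A C) → Strict (domSquare f)
  domSquare-strict f _ = refl

  domSquare-exact : ∀ {A : Obj V} (f : Mono A C) → Exact (domSquare f)
  domSquare-exact {A} f = laxReflects⇒exact (domSquare f)
    (strict⇒lax (domSquare f) (domSquare-strict f))
    (reflects λ { a ((c , c') , c≤c') fa≤c →
         ((a , c') , ≤-trans C fa≤c c≤c') , ≤-refl A , fa≤c , ≤-refl C })

  codSquare : ∀ {B : Obj V} → Mono B C → Square V
  codSquare {B} g = record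
    { P = Comma (idM C) g ; A = Arr ; B = B ; C = C
    ; p₀ = record { fun = λ { ((c , b) , c≤gb) → (c , fun g b) , c≤gb }
                  ; mono = λ { (c≤c' , b≤b') → c≤c' , mono g b≤b' } }
    ; p₁ = p₁ (commaSquare (idM C) g)
    ; f = cod ; g = g }

  codSquare-strict : ∀ {B : Obj V} (g : Mono B C) → Strict (codSquare g)
  codSquare-strict g _ = refl

  codSquare-exact : ∀ {B : Obj V} (g : Mono B C) → Exact (codSquare g)
  codSquare-exact {B} g = laxReflects⇒exact (codSquare g)
    (strict⇒lax (codSquare g) (codSquare-strict g))
    (reflects λ { ((c , c') , c≤c') b c'≤gb →
         ((c , b) , ≤-trans C c≤c' c'≤gb) , (≤-refl C , c'≤gb) , ≤-refl B })

-- Its apex is the object E of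
-- triples a ≤ p₀ w, p₁ w ≤ b; it maps to f/1 and 1/g (laxness makes
-- fa ≤ gb) and to the apex of s.  The resulting square over Arr is strict,
-- exact because s is, and the grid it forms is dominated by s.
module LaxDecomposition {V : Base} (s : Square V) (lax : Lax s) (ex : Exact s) where
  private module S = Square s
  open Arrows S.C

  E : Obj V
  E = Comma (S.p₁ ∘M p₁ (commaSquare (idM S.A) S.p₀)) (idM S.B)

  private
    eA : Carrier E → Carrier S.A
    eA e = proj₁ (proj₁ (proj₁ (proj₁ e)))

    eB : Carrier E → Carrier S.B
    eB e = proj₂ (proj₁ e)

    connects : (e : Carrier E) → S.C ⟦ fun S.f (eA e) ≤ fun S.g (eB e) ⟧
    connects ((((a , w) , a≤p₀w) , b) , p₁w≤b) =
      laxSound s lax a b (w , a≤p₀w , p₁w≤b)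

  toApex : Mono E S.P
  toApex = record { fun = λ e → proj₂ (proj₁ (proj₁ (proj₁ e)))
                  ; mono = λ le → proj₂ (proj₁ le) }

  toDom : Mono E (P (domSquare S.f))
  toDom = record { fun = λ e → (eA e , fun S.g (eB e)) , connects e
                 ; mono = λ { (le , b≤b') → proj₁ le , mono S.g b≤b' } }

  toCod : Mono E (P (codSquare S.g))
  toCod = record { fun = λ e → (fun S.f (eA e) , eB e) , connects e
                 ; mono = λ { (le , b≤b') → mono S.f (proj₁ le) , b≤b' } }

  middleSquare : Square V
  middleSquare = record
    { P = E ; A = P (domSquare S.f) ; B = P (codSquare S.g) ; C = Arr
    ; p₀ = toDom ; p₁ = toCod ; f = p₁ (domSquare S.f) ; g = p₀ (codSquare S.g) }

  middleSquare-strict : Strict middleSquare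
  middleSquare-strict _ = refl

  middleSquare-exact : Exact middleSquare
  middleSquare-exact = laxReflects⇒exact middleSquare
    (strict⇒lax middleSquare middleSquare-strict)
    (reflects λ { ((a , c') , fa≤c') ((c , b) , c≤gb) (fa≤c , c'≤gb) →
         let (w , a≤p₀w , p₁w≤b) = witness (exactReflects {s = s} ex) a b (≤-trans S.C fa≤c c≤gb)
         in ((((a , w) , a≤p₀w) , b) , p₁w≤b) , (≤-refl S.A , c'≤gb) , (fa≤c , ≤-refl S.B) })

  domination₀ : (p₀ (domSquare S.f) ∘M toDom) ≼ (S.p₀ ∘M toApex)
  domination₀ e = proj₂ (proj₁ (proj₁ e))

  domination₁ : (S.p₁ ∘M toApex) ≼ (p₁ (codSquare S.g) ∘M toCod)
  domination₁ e = proj₂ e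

module _ {V : Base} (T : LocMonFunctor V) where

  strictAndIdId⇒laxExact : PreservesStrictExact T → PreservesIdIdComma T →
                           PreservesLaxExact T
  strictAndIdId⇒laxExact strictPres idIdPres s lax ex =
    laxReflects⇒exact (mapSquare T s) (mapLax T s lax) reflectsImage
    where
      open Arrows (C s)
      open LaxDecomposition s lax ex

      preserved : (t : Square V) → Strict t → Exact t →
        Reflects (F₁ T (p₀ t)) (F₁ T (p₁ t)) (F₁ T (f t)) (F₁ T (g t))
      preserved t strict exact = exactReflects {s = mapSquare T t} (strictPres t strict exact)

      grid : Reflects (F₁ T (p₀ (domSquare (f s))) ∘M F₁ T toDom)
                      (F₁ T (p₁ (codSquare (g s))) ∘M F₁ T toCod)
                      (F₁ T (idM (C s)) ∘M F₁ T (f s)) (F₁ T (idM (C s)) ∘M F₁ T (g s))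
      grid = pasteVertical
        (pasteHorizontal (preserved middleSquare middleSquare-strict middleSquare-exact)
                         (preserved (codSquare (g s)) (codSquare-strict (g s)) (codSquare-exact (g s))))
        (pasteHorizontal (preserved (domSquare (f s)) (domSquare-strict (f s)) (domSquare-exact (f s)))
                         (exactReflects {s = mapSquare T (commaSquare (idM (C s)) (idM (C s)))}
                                        (idIdPres (C s))))

      reflectsImage : Reflects (F₁ T (p₀ s)) (F₁ T (p₁ s)) (F₁ T (f s)) (F₁ T (g s))
      reflectsImage = reflectsCompare grid (F₁ T toApex)
        (mapTwoCell T toDom (p₀ (domSquare (f s))) toApex (p₀ s) domination₀)
        (mapTwoCell T toApex (p₁ s) toCod (p₁ (codSquare (g s))) domination₁)
        (mapId≼ T (F₁ T (f s))) (≼mapId T (F₁ T (g s)))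

  laxExact⇒strictExact : PreservesLaxExact T → PreservesStrictExact T
  laxExact⇒strictExact laxPres s strict = laxPres s (strict⇒lax s strict)

  laxExact⇒allComma : PreservesLaxExact T → PreservesAllComma T
  laxExact⇒allComma laxPres A B C f g =
    laxPres (commaSquare f g) (commaLax f g) (commaExact f g)

  allComma⇒oneSided : PreservesAllComma T → PreservesOneSidedComma T
  allComma⇒oneSided allPres A B f = allPres A B B f (idM B) , allPres B A B (idM B) f

  oneSided⇒idId : PreservesOneSidedComma T → PreservesIdIdComma T
  oneSided⇒idId oneSidedPres A = proj₁ (oneSidedPres A A (idM A))

  allComma⇒idId : PreservesAllComma T → PreservesIdIdComma T
  allComma⇒idId allPres = oneSided⇒idId (allComma⇒oneSided allPres)

mainTheorem7 : (V : Base) (T : LocMonFunctor V) →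
    (PreservesLaxExact T ⇔ (PreservesStrictExact T × PreservesIdIdComma T))
    × (PreservesLaxExact T ⇔ (PreservesStrictExact T × PreservesOneSidedComma T))
    × (PreservesLaxExact T ⇔ (PreservesStrictExact T × PreservesAllComma T))
mainTheorem7 V T =
    mk⇔ (λ h → strict h , allComma⇒idId T (allComma h))
        (λ (st , ii) → fromIdId st ii)
  , mk⇔ (λ h → strict h , allComma⇒oneSided T (allComma h))
        (λ (st , os) → fromIdId st (oneSided⇒idId T os))
  , mk⇔ (λ h → strict h , allComma h)
        (λ (st , ac) → fromIdId st (allComma⇒idId T ac))
  where
    strict : PreservesLaxExact T → PreservesStrictExact T
    strict = laxExact⇒strictExact T

    allComma : PreservesLaxExact T → PreservesAllComma T
    allComma = laxExact⇒allComma T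

    fromIdId : PreservesStrictExact T → PreservesIdIdComma T → PreservesLaxExact T
    fromIdId = strictAndIdId⇒laxExact T
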